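{- $f(4)\geq 8$; that is, there exists a $4$-anti-traceable oriented graph on $7$ vertices which has no hamiltonian anti-directed path (namely the Paley tournament $PT_7$).
   Context: An oriented path $x_1\dots x_p$ is anti-directed if every two consecutive arcs have opposite orientations. A digraph is anti-traceable if it has an anti-directed path through all its vertices, and $k$-anti-traceable if it has at least $k$ vertices and every induced subdigraph on $k$ vertices is anti-traceable. $f(k)$ denotes the minimum integer $f\ge k$ such that every $k$-anti-traceable oriented graph on at least $f$ vertices is anti-traceable. The Paley tournament $PT_7$ has vertex set $GF(7)$ and an arc $i\to j$ whenever $j-i$ is a nonzero square in $GF(7)$. -}

module Defs where

open import Data.Nat using (ℕ; zero; suc; _+_; _∸_; _≤_; _%_)
open import Data.Fin using (Fin; toℕ)
open import Data.Fin.Subset using (Subset; _∈_; ∣_∣)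
open import Data.Bool using (Bool; true; false; not)
open import Data.List using (List; []; _∷_)
open import Data.List.Relation.Unary.Unique.Propositional using (Unique)
import Data.List.Membership.Propositional as L
open import Data.Product using (Σ; _×_; ∃)
open import Data.Sum using (_⊎_)
open import Data.Unit using (⊤)
open import Relation.Binary.PropositionalEquality using (_≡_)
open import Relation.Nullary using (¬_)
open import Function.Bundles using (_⇔_)

Digraph : ℕ → Set₁
Digraph n = Fin n → Fin n → Set

IsOriented : ∀ {n} → Digraph n → Set
IsOriented {n} D = (∀ x → ¬ D x x) × (∀ x y → D x y → ¬ D y x)

AltFrom : ∀ {n} → Digraph n → Bool → List (Fin n) → Set
AltFrom D d []           = ⊤
AltFrom D d (x ∷ [])     = ⊤
AltFrom D true  (x ∷ y ∷ r) = D x y × AltFrom D false (y ∷ r)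
AltFrom D false (x ∷ y ∷ r) = D y x × AltFrom D true (y ∷ r)

AntiDirectedPath : ∀ {n} → Digraph n → List (Fin n) → Set
AntiDirectedPath D xs = Unique xs × Σ Bool (λ d → AltFrom D d xs)

-- The induced subdigraph on S is anti-traceable: some anti-directed path
-- (using arcs of D, all of whose endpoints lie in S) has vertex set exactly S.
InducedAntiTraceable : ∀ {n} → Digraph n → Subset n → Set
InducedAntiTraceable {n} D S =
  Σ (List (Fin n)) λ xs → AntiDirectedPath D xs × (∀ v → (v L.∈ xs) ⇔ (v ∈ S))

AntiTraceable : ∀ {n} → Digraph n → Set
AntiTraceable {n} D =
  Σ (List (Fin n)) λ xs → AntiDirectedPath D xs × (∀ v → v L.∈ xs)

KAntiTraceable : ℕ → ∀ {n} → Digraph n → Set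
KAntiTraceable k {n} D =
  k ≤ n × (∀ (S : Subset n) → ∣ S ∣ ≡ k → InducedAntiTraceable D S)

NonzeroSquare7 : ℕ → Set
NonzeroSquare7 m = (m ≡ 1) ⊎ (m ≡ 2) ⊎ (m ≡ 4)

PT7 : Digraph 7
PT7 i j = NonzeroSquare7 ((7 + toℕ j ∸ toℕ i) % 7)

-- Every notion in the statement is decidable for a digraph on Fin n with decidable arcs.
-- The vertices of an anti-directed path are distinct, so a path spanning a vertex set S
-- has exactly as many vertices as S and hence occurs among the finitely many alternating
-- walks of that length; searching them decides induced anti-traceability. All three claims about
-- PT₇ are then obtained by running these decision procedures.
module Submission where

open import Defs
open import Data.Bool using (Bool; true; false; not)
open import Data.Fin using (Fin)
open import Data.Fin.Properties using (all?) renaming (_≟_ to _≟ᶠ_)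
open import Data.Fin.Subset using (Subset; ⊤; ∣_∣) renaming (_∈_ to _∈ₛ_)
open import Data.Fin.Subset.Properties using (_∈?_; ∈⊤; anySubset?)
open import Data.List using (List; []; _∷_; [_]; _++_; length; map; concatMap; filter; allFin)
open import Data.List.Membership.Propositional using (_∈_; lose)
open import Data.List.Membership.Propositional.Properties
  using (∈-allFin; ∈-filter⁺; ∈-filter⁻; ∈-map⁺; ∈-concatMap⁺; ∈-++⁺ˡ; ∈-++⁺ʳ)
open import Data.List.Membership.Propositional.Properties.WithK using (unique∧set⇒bag)
open import Data.List.Relation.Binary.BagAndSetEquality using (_∼[_]_; set; ∼bag⇒↭)
open import Data.List.Relation.Binary.Permutation.Propositional.Properties using (↭-length)
open import Data.List.Relation.Unary.Any using (here; satisfied) renaming (any? to anyₗ?)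
open import Data.List.Relation.Unary.Unique.Propositional using (Unique)
open import Data.List.Relation.Unary.Unique.Propositional.Properties using (allFin⁺; filter⁺)
open import Data.Nat using (ℕ; zero; suc; _≤?_; _≟_)
open import Data.Product using (_×_; _,_; proj₁; proj₂)
open import Data.Sum using (inj₁; inj₂)
open import Data.Unit using (tt)
open import Function using (_∘_)
open import Function.Bundles using (_⇔_; mk⇔; Equivalence)
open import Relation.Binary using (Decidable)
open import Relation.Binary.PropositionalEquality using (_≡_; refl; subst)
open import Relation.Nullary using (¬_; Dec; yes)
open import Relation.Nullary.Decidable
  using (map′; _×-dec_; _⊎-dec_; _→-dec_; ¬?; decidable-stable; from-yes; from-no)

unique∧set⇒length≡ : ∀ {a} {A : Set a} {xs ys : List A} →
                     Unique xs → Unique ys → xs ∼[ set ] ys → length xs ≡ length ys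
unique∧set⇒length≡ uxs uys xs≈ys = ↭-length (∼bag⇒↭ (unique∧set⇒bag uxs uys xs≈ys))

module _ {n : ℕ} where

  members : Subset n → List (Fin n)
  members S = filter (_∈? S) (allFin n)

  members-unique : ∀ S → Unique (members S)
  members-unique S = filter⁺ (_∈? S) (allFin⁺ n)

  ∈-members : ∀ S v → v ∈ members S ⇔ v ∈ₛ S
  ∈-members S v = mk⇔ (proj₂ ∘ ∈-filter⁻ (_∈? S) {xs = allFin n})
                      (∈-filter⁺ (_∈? S) (∈-allFin v))

  allSubset? : ∀ {p} {P : Subset n → Set p} → (∀ S → Dec (P S)) → Dec (∀ S → P S)
  allSubset? P? = map′ (λ ∄¬P S → decidable-stable (P? S) (λ ¬PS → ∄¬P (S , ¬PS)))
                       (λ ∀P (S , ¬PS) → ¬PS (∀P S))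
                       (¬? (anySubset? (¬? ∘ P?)))

module Decide {n : ℕ} {D : Digraph n} (D? : Decidable D) where

  open import Data.List.Relation.Unary.Unique.DecPropositional (_≟ᶠ_ {n}) using (unique?)
  open import Data.List.Membership.DecPropositional (_≟ᶠ_ {n}) using () renaming (_∈?_ to _∈ₗ?_)

  isOriented? : Dec (IsOriented D)
  isOriented? = all? (λ x → ¬? (D? x x)) ×-dec all? λ x → all? λ y → D? x y →-dec ¬? (D? y x)

  Arc : Bool → Fin n → Fin n → Set
  Arc true  x y = D x y
  Arc false x y = D y x

  arc? : ∀ d x y → Dec (Arc d x y)
  arc? true  x y = D? x y
  arc? false x y = D? y x

  altFrom-∷∷ : ∀ d {x y ys} → AltFrom D d (x ∷ y ∷ ys) → Arc d x y × AltFrom D (not d) (y ∷ ys)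
  altFrom-∷∷ true  alt = alt
  altFrom-∷∷ false alt = alt

  altFrom? : ∀ d xs → Dec (AltFrom D d xs)
  altFrom? d     []           = yes tt
  altFrom? d     (x ∷ [])     = yes tt
  altFrom? true  (x ∷ y ∷ ys) = D? x y ×-dec altFrom? false (y ∷ ys)
  altFrom? false (x ∷ y ∷ ys) = D? y x ×-dec altFrom? true (y ∷ ys)

  antiDirectedPath? : ∀ xs → Dec (AntiDirectedPath D xs)
  antiDirectedPath? xs = unique? xs ×-dec
    map′ (λ { (inj₁ alt) → true , alt ; (inj₂ alt) → false , alt })
         (λ { (true , alt) → inj₁ alt ; (false , alt) → inj₂ alt })
         (altFrom? true xs ⊎-dec altFrom? false xs)

  altWalksFrom : ℕ → Bool → Fin n → List (List (Fin n))
  altWalksFrom zero    d x = [ x ∷ [] ]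
  altWalksFrom (suc k) d x =
    concatMap (λ y → map (x ∷_) (altWalksFrom k (not d) y)) (filter (arc? d x) (allFin n))

  altWalks : ℕ → Bool → List (List (Fin n))
  altWalks zero    d = [ [] ]
  altWalks (suc k) d = concatMap (altWalksFrom k d) (allFin n)

  ∈-altWalksFrom : ∀ d x ys → AltFrom D d (x ∷ ys) → x ∷ ys ∈ altWalksFrom (length ys) d x
  ∈-altWalksFrom d x []       _   = here refl
  ∈-altWalksFrom d x (y ∷ ys) alt with xy , alt′ ← altFrom-∷∷ d alt =
    ∈-concatMap⁺ _ (lose (∈-filter⁺ (arc? d x) (∈-allFin y) xy)
                         (∈-map⁺ (x ∷_) (∈-altWalksFrom (not d) y ys alt′)))

  ∈-altWalks : ∀ d xs → AltFrom D d xs → xs ∈ altWalks (length xs) d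
  ∈-altWalks d []       _   = here refl
  ∈-altWalks d (x ∷ xs) alt = ∈-concatMap⁺ _ (lose (∈-allFin x) (∈-altWalksFrom d x xs alt))

  IsPathOn : Subset n → List (Fin n) → Set
  IsPathOn S xs = AntiDirectedPath D xs × (∀ v → (v ∈ xs) ⇔ (v ∈ₛ S))

  isPathOn? : ∀ S xs → Dec (IsPathOn S xs)
  isPathOn? S xs = antiDirectedPath? xs ×-dec
    map′ (λ both v → mk⇔ (proj₁ (both v)) (proj₂ (both v)))
         (λ xs≈S v → Equivalence.to (xs≈S v) , Equivalence.from (xs≈S v))
         (all? λ v → (v ∈ₗ? xs →-dec v ∈? S) ×-dec (v ∈? S →-dec v ∈ₗ? xs))

  pathOn-length : ∀ S xs → IsPathOn S xs → length xs ≡ length (members S)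
  pathOn-length S xs ((uxs , _) , xs≈S) = unique∧set⇒length≡ uxs (members-unique S) λ {v} →
    mk⇔ (Equivalence.from (∈-members S v) ∘ Equivalence.to (xs≈S v))
        (Equivalence.from (xs≈S v) ∘ Equivalence.to (∈-members S v))

  candidates : Subset n → List (List (Fin n))
  candidates S = altWalks (length (members S)) true ++ altWalks (length (members S)) false

  ∈-candidates : ∀ S xs → IsPathOn S xs → xs ∈ candidates S
  ∈-candidates S xs p@((_ , true , alt) , _) =
    ∈-++⁺ˡ (subst (λ m → xs ∈ altWalks m true) (pathOn-length S xs p) (∈-altWalks true xs alt))
  ∈-candidates S xs p@((_ , false , alt) , _) =
    ∈-++⁺ʳ (altWalks (length (members S)) true)
           (subst (λ m → xs ∈ altWalks m false) (pathOn-length S xs p) (∈-altWalks false xs alt))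

  inducedAntiTraceable? : ∀ S → Dec (InducedAntiTraceable D S)
  inducedAntiTraceable? S = map′ satisfied (λ (xs , p) → lose (∈-candidates S xs p) p)
                                 (anyₗ? (isPathOn? S) (candidates S))

  kAntiTraceable? : ∀ k → Dec (KAntiTraceable k D)
  kAntiTraceable? k = k ≤? n ×-dec allSubset? λ S → ∣ S ∣ ≟ k →-dec inducedAntiTraceable? S

  antiTraceable? : Dec (AntiTraceable D)
  antiTraceable? = map′ (λ (xs , p , xs≈⊤) → xs , p , λ v → Equivalence.from (xs≈⊤ v) ∈⊤)
                        (λ (xs , p , cover) → xs , p , λ v → mk⇔ (λ _ → ∈⊤) (λ _ → cover v))
                        (inducedAntiTraceable? ⊤)

nonzeroSquare7? : ∀ m → Dec (NonzeroSquare7 m)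
nonzeroSquare7? m = m ≟ 1 ⊎-dec m ≟ 2 ⊎-dec m ≟ 4

PT7? : Decidable PT7
PT7? i j = nonzeroSquare7? _

open Decide PT7?

proposition1 : IsOriented PT7 × KAntiTraceable 4 PT7 × ¬ AntiTraceable PT7
proposition1 = from-yes isOriented? , from-yes (kAntiTraceable? 4) , from-no antiTraceable?
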